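{- Let $a_1,\dots,a_4,p_1,\dots,p_4,x_1,\dots,x_4,q_1,\dots,q_4$ be nonzero complex numbers. Put $K:=a_1a_2a_3a_4$, $L:=(p_1p_2p_3p_4)^{1/2}$, $K_0:=x_1x_2x_3x_4$, $L_0:=(q_1q_2q_3q_4)^{1/2}$. For an integer $k\ge -1$ define $$E_k[\bar a;\bar p]:=\big(a_1(p_1p_3)^{k/2}-a_2a_4(p_2p_4)^{k/2}/a_3\big)\big(a_1(p_1p_4)^{k/2}-a_2a_3(p_2p_3)^{k/2}/a_4\big),$$ $$D_k[\bar x;\bar q]:=x_1x_2(q_1q_2)^{k/2}-x_3x_4(q_3q_4)^{k/2}.$$ Then for every integer $n\ge0$ (whenever no denominator vanishes) $$\sum_{k=0}^{n-1}\frac{E_{k-1}[\bar a;\bar p]}{(p_3p_4)^{(k-1)/2}}\frac{(a_1^2/p_1;p_1)_k(a_2^2/p_2;p_2)_k(x_1^2;q_1)_k}{(Kp_3/(La_3^2);L/p_3)_{k+1}(Kp_4/(La_4^2);L/p_4)_{k+1}(K_0/x_2^2;L_0/q_2)_k}$$ $$=1-\frac{(a_1^2/p_1;p_1)_n(a_2^2/p_2;p_2)_n(x_1^2;q_1)_n}{(Kp_3/(La_3^2);L/p_3)_n(Kp_4/(La_4^2);L/p_4)_n(K_0/x_2^2;L_0/q_2)_n}$$ $$-\frac{x_1}{x_2}\sum_{k=0}^{n-1}D_k[\bar x;\bar q]\Big(\frac{q_1}{q_2}\Big)^{k/2}\frac{(a_1^2/p_1;p_1)_{k+1}(a_2^2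/p_2;p_2)_{k+1}(x_1^2;q_1)_k}{(Kp_3/(La_3^2);L/p_3)_{k+1}(Kp_4/(La_4^2);L/p_4)_{k+1}(K_0/x_2^2;L_0/q_2)_{k+1}}.$$
   Context: For a complex number $z$, a nonzero complex base $p$ and an integer $k\ge0$, $(z;p)_k:=\prod_{j=0}^{k-1}(1-zp^j)$. Square roots $p_i^{1/2},q_i^{1/2}$ are fixed, and every half-integer power of a product or quotient of the $p_i$ (resp. $q_i$) is understood as the corresponding product of powers of these fixed roots, e.g. $(q_1/q_2)^{k/2}=(q_1^{1/2}/q_2^{1/2})^k$. -}

module Defs where

open import Level using (_⊔_) renaming (suc to lsuc)
open import Algebra.Bundles using (CommutativeRing)
open import Data.Nat using (ℕ; zero; suc)
open import Data.Integer using (ℤ; +_; -[1+_])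
open import Data.Fin using (Fin)
open import Relation.Nullary using (¬_)

record Field c ℓ : Set (lsuc (c ⊔ ℓ)) where
  field
    commutativeRing : CommutativeRing c ℓ
  open CommutativeRing commutativeRing public
  field
    _⁻¹ : Carrier → Carrier
    1≉0 : ¬ (1# ≈ 0#)
    inverseʳ : ∀ x → ¬ (x ≈ 0#) → (x * (x ⁻¹)) ≈ 1#

i1 i2 i3 i4 : Fin 4
i1 = Fin.zero
i2 = Fin.suc Fin.zero
i3 = Fin.suc (Fin.suc Fin.zero)
i4 = Fin.suc (Fin.suc (Fin.suc Fin.zero))

module WithField {c ℓ} (F : Field c ℓ) where
  open Field F

  infixl 7 _/_
  infixr 8 _^ⁿ_ _^ᶻ_

  _/_ : Carrier → Carrier → Carrier
  x / y = x * (y ⁻¹)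

  _^ⁿ_ : Carrier → ℕ → Carrier
  x ^ⁿ zero = 1#
  x ^ⁿ suc n = x * (x ^ⁿ n)

  _^ᶻ_ : Carrier → ℤ → Carrier
  x ^ᶻ (+ n) = x ^ⁿ n
  x ^ᶻ -[1+ n ] = (x ⁻¹) ^ⁿ suc n

  poch : Carrier → Carrier → ℕ → Carrier
  poch z p zero = 1#
  poch z p (suc k) = poch z p k * (1# - z * (p ^ⁿ k))

  sumTo : ℕ → (ℕ → Carrier) → Carrier
  sumTo zero f = 0#
  sumTo (suc n) f = sumTo n f + f n

  sq : Carrier → Carrier
  sq y = y * y

  -- Data of the theorem: a, p, x, q the parameters; sp, sq' the fixed square
  -- roots of p, q (so p i^{1/2} = sp i, q i^{1/2} = sq' i; the theorem
  -- assumes sp i * sp i ≈ p i and sq' i * sq' i ≈ q i).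
  module Quantities (a p sp x q sq' : Fin 4 → Carrier) where

    K L K₀ L₀ : Carrier
    K = a i1 * a i2 * a i3 * a i4
    L = sp i1 * sp i2 * sp i3 * sp i4
    K₀ = x i1 * x i2 * x i3 * x i4
    L₀ = sq' i1 * sq' i2 * sq' i3 * sq' i4

    -- E_k[a;p], k an integer (used for k ≥ -1); (p_i p_j)^{k/2} = (sp i sp j)^k
    E : ℤ → Carrier
    E k = (a i1 * (sp i1 * sp i3) ^ᶻ k - a i2 * a i4 * (sp i2 * sp i4) ^ᶻ k / a i3)
        * (a i1 * (sp i1 * sp i4) ^ᶻ k - a i2 * a i3 * (sp i2 * sp i3) ^ᶻ k / a i4)

    D : ℕ → Carrier
    D k = x i1 * x i2 * (sq' i1 * sq' i2) ^ⁿ k - x i3 * x i4 * (sq' i3 * sq' i4) ^ⁿ k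

    Num : ℕ → Carrier
    Num k = poch (sq (a i1) / p i1) (p i1) k * poch (sq (a i2) / p i2) (p i2) k
          * poch (sq (x i1)) (q i1) k

    Num' : ℕ → Carrier
    Num' k = poch (sq (a i1) / p i1) (p i1) (suc k) * poch (sq (a i2) / p i2) (p i2) (suc k)
           * poch (sq (x i1)) (q i1) k

    B₃ B₄ B₀ : ℕ → Carrier
    B₃ k = poch (K * p i3 / (L * sq (a i3))) (L / p i3) k
    B₄ k = poch (K * p i4 / (L * sq (a i4))) (L / p i4) k
    B₀ k = poch (K₀ / sq (x i2)) (L₀ / q i2) k

    T₁ : ℕ → Carrier
    T₁ k = (E (+ k Data.Integer.- + 1) / ((sp i3 * sp i4) ^ᶻ (+ k Data.Integer.- + 1)))
         * (Num k / (B₃ (suc k) * B₄ (suc k) * B₀ k))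

    T₂ : ℕ → Carrier
    T₂ k = D k * (sq' i1 / sq' i2) ^ⁿ k
         * (Num' k / (B₃ (suc k) * B₄ (suc k) * B₀ (suc k)))

    LHS RHS : ℕ → Carrier
    LHS n = sumTo n T₁
    RHS n = 1# - Num n / (B₃ n * B₄ n * B₀ n) - (x i1 / x i2) * sumTo n T₂

{-# OPTIONS --safe #-}
module Submission where

-- The sum telescopes. With R n the quotient of the numerator Pochhammer
-- product by the denominator one, the k-th summand on the left plus (x₁/x₂)
-- times the k-th summand on the right equals R k − R (k+1); as R 0 = 1, summing
-- gives the theorem. Clearing the common Pochhammer factors, this reduces to
-- two identities between the k-th factors. With yᵢ = aᵢ pᵢ^((k−1)/2),
--   E_{k−1} / (p₃p₄)^((k−1)/2) = (y₁ − y₂ρ)(y₁ − y₂σ)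
--     = (1 − y₁y₂ρ)(1 − y₁y₂σ) − (1 − y₁²)(1 − y₂²),
-- where ρ = y₄/y₃ and σ = y₃/y₄, the second step using only ρσ = 1; and with
-- ξᵢ = xᵢ qᵢ^(k/2),
--   (x₁/x₂) D_k (q₁/q₂)^(k/2) = (ξ₁/ξ₂)(ξ₁ξ₂ − ξ₃ξ₄) = (1 − ξ₁ξ₃ξ₄/ξ₂) − (1 − ξ₁²).

open import Defs
open import Data.Fin using (Fin)
open import Relation.Nullary using (¬_)

open import Algebra.Bundles using (CommutativeRing)
open import Algebra.Solver.Ring.AlmostCommutativeRing
  using (fromCommutativeRing; _-Raw-AlmostCommutative⟶_)
open import Data.Nat as ℕ using (ℕ; zero; suc; _≤_; _<_; _≤′_; ≤′-refl; ≤′-step)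
import Data.Nat.Properties as ℕ
open import Data.Integer as ℤ using (ℤ; +_; -[1+_]; _⊖_)
import Data.Integer.Properties as ℤ
import Data.Maybe as Maybe
open import Relation.Nullary.Decidable using (dec⇒maybe)
import Relation.Binary.PropositionalEquality as ≡

-- The ring solvers of the standard library decide equality of coefficients; an
-- abstract ring has no decidable equality, so the coefficients are integers,
-- interpreted through the canonical map ℤ → R.
module IntegerRingSolver {c ℓ} (R : CommutativeRing c ℓ) where
  open CommutativeRing R
  open import Algebra.Properties.Ring ring using (-‿distribˡ-*; -‿distribʳ-*; -‿involutive; -0#≈0#)
  open import Algebra.Properties.AbelianGroup +-abelianGroup using (⁻¹-∙-comm)
  open import Algebra.Properties.CommutativeSemigroup +-commutativeSemigroup using (interchange)
  open import Algebra.Properties.Monoid.Mult.TCOptimised +-monoid using (_×_; 1+×; ×-homo-+)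
  open import Algebra.Properties.Semiring.Mult.TCOptimised semiring using (×1-homo-*)
  open import Relation.Binary.Reasoning.Setoid setoid

  fromℤ : ℤ → Carrier
  fromℤ (+ n)    = n × 1#
  fromℤ -[1+ n ] = - (suc n × 1#)

  [z+x]-[z+y]≈x-y : ∀ x y z → (z + x) - (z + y) ≈ x - y
  [z+x]-[z+y]≈x-y x y z = begin
    (z + x) - (z + y)    ≈⟨ +-congˡ (⁻¹-∙-comm z y) ⟨
    (z + x) + (- z - y)  ≈⟨ interchange z x (- z) (- y) ⟩
    (z - z) + (x - y)    ≈⟨ +-congʳ (-‿inverseʳ z) ⟩
    0# + (x - y)         ≈⟨ +-identityˡ _ ⟩
    x - y                ∎

  fromℤ-⊖ : ∀ m n → fromℤ (m ⊖ n) ≈ m × 1# - n × 1#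
  fromℤ-⊖ m zero = begin
    fromℤ (m ⊖ 0)  ≡⟨ ≡.cong fromℤ (ℤ.⊖-≥ {m} ℕ.z≤n) ⟩
    m × 1#         ≈⟨ +-identityʳ _ ⟨
    m × 1# + 0#    ≈⟨ +-congˡ -0#≈0# ⟨
    m × 1# - 0#    ∎
  fromℤ-⊖ zero (suc n) = begin
    fromℤ (0 ⊖ suc n)  ≡⟨ ≡.cong fromℤ (ℤ.⊖-≤ {0} {suc n} ℕ.z≤n) ⟩
    - (suc n × 1#)     ≈⟨ +-identityˡ _ ⟨
    0# - suc n × 1#    ∎
  fromℤ-⊖ (suc m) (suc n) = begin
    fromℤ (suc m ⊖ suc n)          ≡⟨ ≡.cong fromℤ (ℤ.[1+m]⊖[1+n]≡m⊖n m n) ⟩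
    fromℤ (m ⊖ n)                  ≈⟨ fromℤ-⊖ m n ⟩
    m × 1# - n × 1#                ≈⟨ [z+x]-[z+y]≈x-y _ _ 1# ⟨
    (1# + m × 1#) - (1# + n × 1#)  ≈⟨ +-cong (1+× m 1#) (-‿cong (1+× n 1#)) ⟨
    suc m × 1# - suc n × 1#        ∎

  fromℤ-+ : ∀ i j → fromℤ (i ℤ.+ j) ≈ fromℤ i + fromℤ j
  fromℤ-+ (+ m)    (+ n)    = ×-homo-+ 1# m n
  fromℤ-+ (+ m)    -[1+ n ] = fromℤ-⊖ m (suc n)
  fromℤ-+ -[1+ m ] (+ n)    = trans (fromℤ-⊖ n (suc m)) (+-comm _ _)
  fromℤ-+ -[1+ m ] -[1+ n ] = begin
    - (suc (suc (m ℕ.+ n)) × 1#)  ≡⟨ ≡.cong (λ k → - (suc k × 1#)) (ℕ.+-suc m n) ⟨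
    - ((suc m ℕ.+ suc n) × 1#)    ≈⟨ -‿cong (×-homo-+ 1# (suc m) (suc n)) ⟩
    - (suc m × 1# + suc n × 1#)   ≈⟨ ⁻¹-∙-comm _ _ ⟨
    - (suc m × 1#) - suc n × 1#   ∎

  fromℤ-neg : ∀ i → fromℤ (ℤ.- i) ≈ - fromℤ i
  fromℤ-neg (+ zero)  = sym -0#≈0#
  fromℤ-neg (+ suc n) = refl
  fromℤ-neg -[1+ n ]  = sym (-‿involutive _)

  fromℤ-+* : ∀ m n → fromℤ (+ m ℤ.* + n) ≈ m × 1# * n × 1#
  fromℤ-+* m n = trans (reflexive (≡.cong fromℤ (≡.sym (ℤ.pos-* m n)))) (×1-homo-* m n)

  fromℤ-* : ∀ i j → fromℤ (i ℤ.* j) ≈ fromℤ i * fromℤ j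
  fromℤ-* (+ m) (+ n) = fromℤ-+* m n
  fromℤ-* (+ m) -[1+ n ] = begin
    fromℤ (+ m ℤ.* ℤ.- + suc n)    ≡⟨ ≡.cong fromℤ (ℤ.neg-distribʳ-* (+ m) (+ suc n)) ⟨
    fromℤ (ℤ.- (+ m ℤ.* + suc n))  ≈⟨ fromℤ-neg (+ m ℤ.* + suc n) ⟩
    - fromℤ (+ m ℤ.* + suc n)      ≈⟨ -‿cong (fromℤ-+* m (suc n)) ⟩
    - (m × 1# * suc n × 1#)        ≈⟨ -‿distribʳ-* _ _ ⟩
    m × 1# * - (suc n × 1#)        ∎
  fromℤ-* -[1+ m ] (+ n) = begin
    fromℤ (ℤ.- + suc m ℤ.* + n)    ≡⟨ ≡.cong fromℤ (ℤ.neg-distribˡ-* (+ suc m) (+ n)) ⟨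
    fromℤ (ℤ.- (+ suc m ℤ.* + n))  ≈⟨ fromℤ-neg (+ suc m ℤ.* + n) ⟩
    - fromℤ (+ suc m ℤ.* + n)      ≈⟨ -‿cong (fromℤ-+* (suc m) n) ⟩
    - (suc m × 1# * n × 1#)        ≈⟨ -‿distribˡ-* _ _ ⟩
    - (suc m × 1#) * n × 1#        ∎
  fromℤ-* -[1+ m ] -[1+ n ] = begin
    fromℤ (+ suc m ℤ.* + suc n)      ≈⟨ fromℤ-+* (suc m) (suc n) ⟩
    suc m × 1# * suc n × 1#          ≈⟨ -‿involutive _ ⟨
    - - (suc m × 1# * suc n × 1#)    ≈⟨ -‿cong (-‿distribˡ-* _ _) ⟩
    - (- (suc m × 1#) * suc n × 1#)  ≈⟨ -‿distribʳ-* _ _ ⟩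
    - (suc m × 1#) * - (suc n × 1#)  ∎

  fromℤ-homomorphism : ℤ.+-*-rawRing -Raw-AlmostCommutative⟶ fromCommutativeRing R
  fromℤ-homomorphism = record
    { ⟦_⟧    = fromℤ
    ; +-homo = fromℤ-+
    ; *-homo = fromℤ-*
    ; -‿homo = fromℤ-neg
    ; 0-homo = refl
    ; 1-homo = refl
    }

  fromℤ-≟ : ∀ i j → Maybe.Maybe (fromℤ i ≈ fromℤ j)
  fromℤ-≟ i j = Maybe.map (λ i≡j → reflexive (≡.cong fromℤ i≡j)) (dec⇒maybe (i ℤ.≟ j))

  open import Algebra.Solver.Ring ℤ.+-*-rawRing (fromCommutativeRing R) fromℤ-homomorphism fromℤ-≟ public

module RingIdentities {c ℓ} (R : CommutativeRing c ℓ) where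
  open CommutativeRing R
  open IntegerRingSolver R
  open import Algebra.Properties.Group +-group using () renaming (x≈y⇒x∙y⁻¹≈ε to x≈y⇒x-y≈0)
  open import Relation.Binary.Reasoning.Setoid setoid

  1-‿cong : ∀ {u v} → u ≈ v → 1# - u ≈ 1# - v
  1-‿cong u≈v = +-congˡ (-‿cong u≈v)

  reciprocal-product-identity : ∀ u v ρ σ → ρ * σ ≈ 1# →
    (u - v * ρ) * (u - v * σ) ≈ (1# - u * v * ρ) * (1# - u * v * σ) - (1# - u * u) * (1# - v * v)
  reciprocal-product-identity u v ρ σ ρσ≈1 = begin
    (u - v * ρ) * (u - v * σ)
      ≈⟨ solve 4 (λ u v ρ σ → (u :- v :* ρ) :* (u :- v :* σ) :=
           ((con (+ 1) :- u :* v :* ρ) :* (con (+ 1) :- u :* v :* σ)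
             :- (con (+ 1) :- u :* u) :* (con (+ 1) :- v :* v))
           :+ (ρ :* σ :- con (+ 1)) :* (v :* v :- u :* u :* (v :* v))) refl u v ρ σ ⟩
    rhs + (ρ * σ - 1#) * (v * v - u * u * (v * v))
      ≈⟨ +-congˡ (trans (*-congʳ (x≈y⇒x-y≈0 ρσ≈1)) (zeroˡ _)) ⟩
    rhs + 0#
      ≈⟨ +-identityʳ rhs ⟩
    rhs ∎
    where
    rhs : Carrier
    rhs = (1# - u * v * ρ) * (1# - u * v * σ) - (1# - u * u) * (1# - v * v)

  quotient-product-identity : ∀ q x y z → q * y ≈ x →
    q * (x * y - z) ≈ (1# - q * z) - (1# - x * x)
  quotient-product-identity q x y z qy≈x = begin
    q * (x * y - z)       ≈⟨ solve 4 (λ q x y z → q :* (x :* y :- z) := x :* (q :* y) :- q :* z) refl q x y z ⟩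
    x * (q * y) - q * z   ≈⟨ +-congʳ (*-congˡ qy≈x) ⟩
    x * x - q * z         ≈⟨ solve 2 (λ x w → x :* x :- w :=
                                        (con (+ 1) :- w) :- (con (+ 1) :- x :* x)) refl x (q * z) ⟩
    (1# - q * z) - (1# - x * x) ∎

module FieldProperties {c ℓ} (F : Field c ℓ) where
  open Field F
  open WithField F
  open IntegerRingSolver commutativeRing
  open import Algebra.Properties.CommutativeSemigroup *-commutativeSemigroup using (interchange)
  open import Relation.Binary.Reasoning.Setoid setoid

  x*y≉0 : ∀ {x y} → x ≉ 0# → y ≉ 0# → x * y ≉ 0#
  x*y≉0 {x} {y} x≉0 y≉0 xy≈0 = x≉0 (begin
    x              ≈⟨ *-identityʳ x ⟨
    x * 1#         ≈⟨ *-congˡ (inverseʳ y y≉0) ⟨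
    x * (y * y ⁻¹) ≈⟨ *-assoc x y _ ⟨
    x * y * y ⁻¹   ≈⟨ *-congʳ xy≈0 ⟩
    0# * y ⁻¹      ≈⟨ zeroˡ _ ⟩
    0#             ∎)

  x*y≉0⇒x≉0 : ∀ {x y} → x * y ≉ 0# → x ≉ 0#
  x*y≉0⇒x≉0 {y = y} xy≉0 x≈0 = xy≉0 (trans (*-congʳ x≈0) (zeroˡ y))

  x⁻¹≉0 : ∀ {x} → x ≉ 0# → x ⁻¹ ≉ 0#
  x⁻¹≉0 {x} x≉0 x⁻¹≈0 = 1≉0 (trans (sym (inverseʳ x x≉0)) (trans (*-congˡ x⁻¹≈0) (zeroʳ x)))

  inverseˡ : ∀ {x} → x ≉ 0# → x ⁻¹ * x ≈ 1#
  inverseˡ {x} x≉0 = trans (*-comm _ x) (inverseʳ x x≉0)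

  ⁻¹-unique : ∀ {x y} → x * y ≈ 1# → x ⁻¹ ≈ y
  ⁻¹-unique {x} {y} xy≈1 = begin
    x ⁻¹            ≈⟨ *-identityʳ _ ⟨
    x ⁻¹ * 1#       ≈⟨ *-congˡ xy≈1 ⟨
    x ⁻¹ * (x * y)  ≈⟨ *-assoc _ _ _ ⟨
    x ⁻¹ * x * y    ≈⟨ *-congʳ (inverseˡ x≉0) ⟩
    1# * y          ≈⟨ *-identityˡ y ⟩
    y               ∎
    where
    x≉0 : x ≉ 0#
    x≉0 = x*y≉0⇒x≉0 (λ xy≈0 → 1≉0 (trans (sym xy≈1) xy≈0))

  ⁻¹-cong : ∀ {x y} → x ≉ 0# → x ≈ y → x ⁻¹ ≈ y ⁻¹
  ⁻¹-cong {x} x≉0 x≈y = sym (⁻¹-unique (trans (*-congʳ (sym x≈y)) (inverseʳ x x≉0)))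

  ⁻¹-distrib-* : ∀ {x y} → x ≉ 0# → y ≉ 0# → (x * y) ⁻¹ ≈ x ⁻¹ * y ⁻¹
  ⁻¹-distrib-* {x} {y} x≉0 y≉0 = ⁻¹-unique (begin
    x * y * (x ⁻¹ * y ⁻¹)      ≈⟨ interchange x y _ _ ⟩
    x * x ⁻¹ * (y * y ⁻¹)      ≈⟨ *-cong (inverseʳ x x≉0) (inverseʳ y y≉0) ⟩
    1# * 1#                    ≈⟨ *-identityʳ 1# ⟩
    1#                         ∎)

  /-cong : ∀ {x x′ y y′} → y ≉ 0# → x ≈ x′ → y ≈ y′ → x / y ≈ x′ / y′
  /-cong y≉0 x≈x′ y≈y′ = *-cong x≈x′ (⁻¹-cong y≉0 y≈y′)

  /-*-/ : ∀ {x y z w} → y ≉ 0# → w ≉ 0# → x / y * (z / w) ≈ x * z / (y * w)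
  /-*-/ {x} {y} {z} {w} y≉0 w≉0 =
    trans (interchange x _ z _) (*-congˡ (sym (⁻¹-distrib-* y≉0 w≉0)))

  *-/-cancelˡ : ∀ {c x y} → c ≉ 0# → y ≉ 0# → c * x / (c * y) ≈ x / y
  *-/-cancelˡ {c} {x} {y} c≉0 y≉0 = begin
    c * x / (c * y)            ≈⟨ *-congˡ (⁻¹-distrib-* c≉0 y≉0) ⟩
    c * x * (c ⁻¹ * y ⁻¹)      ≈⟨ interchange c x _ _ ⟩
    c * c ⁻¹ * (x / y)         ≈⟨ *-congʳ (inverseʳ c c≉0) ⟩
    1# * (x / y)               ≈⟨ *-identityˡ _ ⟩
    x / y                      ∎

  x*y/x≈y : ∀ {x y} → x ≉ 0# → x * y / x ≈ y
  x*y/x≈y {x} {y} x≉0 = begin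
    x * y * x ⁻¹    ≈⟨ *-congʳ (*-comm x y) ⟩
    y * x * x ⁻¹    ≈⟨ *-assoc y x _ ⟩
    y * (x * x ⁻¹)  ≈⟨ *-congˡ (inverseʳ x x≉0) ⟩
    y * 1#          ≈⟨ *-identityʳ y ⟩
    y               ∎

  x/y*y≈x : ∀ {x y} → y ≉ 0# → x / y * y ≈ x
  x/y*y≈x {x} {y} y≉0 =
    trans (*-assoc x _ y) (trans (*-congˡ (inverseˡ y≉0)) (*-identityʳ x))

  x/y*[z*y]≈x*z : ∀ {x y z} → y ≉ 0# → x / y * (z * y) ≈ x * z
  x/y*[z*y]≈x*z {x} {y} {z} y≉0 = begin
    x * y ⁻¹ * (z * y)    ≈⟨ interchange x _ z y ⟩
    x * z * (y ⁻¹ * y)    ≈⟨ *-congˡ (inverseˡ y≉0) ⟩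
    x * z * 1#            ≈⟨ *-identityʳ _ ⟩
    x * z                 ∎

  x/y*[y/x]≈1 : ∀ {x y} → x ≉ 0# → y ≉ 0# → x / y * (y / x) ≈ 1#
  x/y*[y/x]≈1 {x} {y} x≉0 y≉0 = begin
    x / y * (y / x)    ≈⟨ /-*-/ y≉0 x≉0 ⟩
    x * y / (y * x)    ≈⟨ *-congʳ (*-comm x y) ⟩
    y * x / (y * x)    ≈⟨ inverseʳ _ (x*y≉0 y≉0 x≉0) ⟩
    1#                 ∎

  ^ⁿ-cong : ∀ {x y} n → x ≈ y → x ^ⁿ n ≈ y ^ⁿ n
  ^ⁿ-cong zero    x≈y = refl
  ^ⁿ-cong (suc n) x≈y = *-cong x≈y (^ⁿ-cong n x≈y)

  ^ⁿ-distrib-* : ∀ x y n → (x * y) ^ⁿ n ≈ x ^ⁿ n * y ^ⁿ n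
  ^ⁿ-distrib-* x y zero    = sym (*-identityʳ 1#)
  ^ⁿ-distrib-* x y (suc n) = trans (*-congˡ (^ⁿ-distrib-* x y n)) (interchange x y _ _)

  ^ⁿ-distrib-*⁴ : ∀ w x y z n → (w * x * y * z) ^ⁿ n ≈ w ^ⁿ n * x ^ⁿ n * y ^ⁿ n * z ^ⁿ n
  ^ⁿ-distrib-*⁴ w x y z n = trans (^ⁿ-distrib-* _ z n)
    (*-congʳ (trans (^ⁿ-distrib-* _ y n) (*-congʳ (^ⁿ-distrib-* w x n))))

  ^ⁿ-≉0 : ∀ {x} n → x ≉ 0# → x ^ⁿ n ≉ 0#
  ^ⁿ-≉0 zero    x≉0 = 1≉0
  ^ⁿ-≉0 (suc n) x≉0 = x*y≉0 x≉0 (^ⁿ-≉0 n x≉0)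

  ⁻¹-^ⁿ : ∀ {x} n → x ≉ 0# → (x ⁻¹) ^ⁿ n ≈ (x ^ⁿ n) ⁻¹
  ⁻¹-^ⁿ zero    x≉0 = sym (⁻¹-unique (*-identityʳ 1#))
  ⁻¹-^ⁿ (suc n) x≉0 =
    trans (*-congˡ (⁻¹-^ⁿ n x≉0)) (sym (⁻¹-distrib-* x≉0 (^ⁿ-≉0 n x≉0)))

  /-^ⁿ : ∀ {x y} n → y ≉ 0# → (x / y) ^ⁿ n ≈ x ^ⁿ n / y ^ⁿ n
  /-^ⁿ {x} {y} n y≉0 = trans (^ⁿ-distrib-* x (y ⁻¹) n) (*-congˡ (⁻¹-^ⁿ n y≉0))

  ^ᶻ-≉0 : ∀ {x} i → x ≉ 0# → x ^ᶻ i ≉ 0#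
  ^ᶻ-≉0 (+ n)    x≉0 = ^ⁿ-≉0 n x≉0
  ^ᶻ-≉0 -[1+ n ] x≉0 = ^ⁿ-≉0 (suc n) (x⁻¹≉0 x≉0)

  ^ᶻ-distrib-* : ∀ {x y} i → x ≉ 0# → y ≉ 0# → (x * y) ^ᶻ i ≈ x ^ᶻ i * y ^ᶻ i
  ^ᶻ-distrib-* {x} {y} (+ n)    _   _   = ^ⁿ-distrib-* x y n
  ^ᶻ-distrib-* {x} {y} -[1+ n ] x≉0 y≉0 =
    trans (^ⁿ-cong (suc n) (⁻¹-distrib-* x≉0 y≉0)) (^ⁿ-distrib-* (x ⁻¹) (y ⁻¹) (suc n))

  ^ⁿ≈^ᶻ[n-1]*x : ∀ {x} n → x ≉ 0# → x ^ⁿ n ≈ x ^ᶻ (+ n ℤ.- + 1) * x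
  ^ⁿ≈^ᶻ[n-1]*x zero    x≉0 = sym (trans (*-congʳ (*-identityʳ _)) (inverseˡ x≉0))
  ^ⁿ≈^ᶻ[n-1]*x {x} (suc n) _ = *-comm x (x ^ⁿ n)

  poch-≉0-≤ : ∀ {z w m n} → m ≤ n → poch z w n ≉ 0# → poch z w m ≉ 0#
  poch-≉0-≤ m≤n = go (ℕ.≤⇒≤′ m≤n)
    where
    go : ∀ {z w m n} → m ≤′ n → poch z w n ≉ 0# → poch z w m ≉ 0#
    go ≤′-refl        h = h
    go (≤′-step m≤′n) h = go m≤′n (x*y≉0⇒x≉0 h)

  sumTo-*ˡ : ∀ n x (f : ℕ → Carrier) → sumTo n (λ k → x * f k) ≈ x * sumTo n f
  sumTo-*ˡ zero    x f = sym (zeroʳ x)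
  sumTo-*ˡ (suc n) x f = trans (+-congʳ (sumTo-*ˡ n x f)) (sym (distribˡ x _ _))

  sumTo-telescoping : ∀ n (f g R : ℕ → Carrier) →
    (∀ k → k < n → f k + g k ≈ R k - R (suc k)) →
    sumTo n f ≈ R 0 - R n - sumTo n g
  sumTo-telescoping zero f g R _ =
    solve 1 (λ r → con (+ 0) := r :- r :- con (+ 0)) refl (R 0)
  sumTo-telescoping (suc n) f g R step = begin
    sumTo n f + f n
      ≈⟨ +-congʳ (sumTo-telescoping n f g R (λ k k<n → step k (ℕ.m<n⇒m<1+n k<n))) ⟩
    R 0 - R n - sumTo n g + f n
      ≈⟨ solve 5 (λ r₀ r s f g → r₀ :- r :- s :+ f := r₀ :- (r :- (f :+ g)) :- (s :+ g))
           refl (R 0) (R n) (sumTo n g) (f n) (g n) ⟩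
    R 0 - (R n - (f n + g n)) - (sumTo n g + g n)
      ≈⟨ +-congʳ (+-congˡ (-‿cong (+-congˡ (-‿cong (step n (ℕ.n<1+n n)))))) ⟩
    R 0 - (R n - (R n - R (suc n))) - (sumTo n g + g n)
      ≈⟨ solve 4 (λ r₀ r r′ s → r₀ :- (r :- (r :- r′)) :- s := r₀ :- r′ :- s)
           refl (R 0) (R n) (R (suc n)) (sumTo n g + g n) ⟩
    R 0 - R (suc n) - (sumTo n g + g n) ∎

  ratio-difference : ∀ {N N′ N″ D D′ D″ α β φ ψ} → D″ ≉ 0# →
    N′ ≈ N * α → N″ ≈ N′ * β → D′ ≈ D * φ → D″ ≈ D′ * ψ →
    N / D - N″ / D″ ≈ (φ - α) * (N / D′) + (ψ - β) * (N′ / D″)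
  ratio-difference {N} {N′} {N″} {D} {D′} {D″} {α} {β} {φ} {ψ} D″≉0 N′≈ N″≈ D′≈ D″≈ = begin
    N / D - N″ / D″
      ≈⟨ +-cong (*-congˡ D⁻¹≈) (-‿cong (*-congʳ (trans N″≈ (*-congʳ N′≈)))) ⟩
    N * (φ * (ψ * W)) - N * α * β * W
      ≈⟨ solve 6 (λ N α β φ ψ W → N :* (φ :* (ψ :* W)) :- N :* α :* β :* W :=
                   (φ :- α) :* (N :* (ψ :* W)) :+ (ψ :- β) :* (N :* α :* W))
           refl N α β φ ψ W ⟩
    (φ - α) * (N * (ψ * W)) + (ψ - β) * (N * α * W)
      ≈⟨ +-cong (*-congˡ (*-congˡ (sym D′⁻¹≈))) (*-congˡ (*-congʳ (sym N′≈))) ⟩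
    (φ - α) * (N / D′) + (ψ - β) * (N′ / D″) ∎
    where
    W : Carrier
    W = D″ ⁻¹
    D′ψW≈1 : D′ * (ψ * W) ≈ 1#
    D′ψW≈1 = trans (sym (*-assoc D′ ψ W)) (trans (*-congʳ (sym D″≈)) (inverseʳ D″ D″≉0))
    D′⁻¹≈ : D′ ⁻¹ ≈ ψ * W
    D′⁻¹≈ = ⁻¹-unique D′ψW≈1
    D⁻¹≈ : D ⁻¹ ≈ φ * (ψ * W)
    D⁻¹≈ = ⁻¹-unique (trans (sym (*-assoc D φ _)) (trans (*-congʳ (sym D′≈)) D′ψW≈1))

module Telescoping {c ℓ} (F : Field c ℓ) where
  open Field F
  open WithField F

  module Summands (a p sp x q sq′ : Fin 4 → Carrier)
    (a≉0 : ∀ i → a i ≉ 0#) (p≉0 : ∀ i → p i ≉ 0#) (x≉0 : ∀ i → x i ≉ 0#) (q≉0 : ∀ i → q i ≉ 0#)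
    (sp²≈p : ∀ i → sp i * sp i ≈ p i) (sq′²≈q : ∀ i → sq′ i * sq′ i ≈ q i) where

    open Quantities a p sp x q sq′
    open FieldProperties F
    open RingIdentities commutativeRing
    open IntegerRingSolver commutativeRing
    open import Algebra.Properties.CommutativeSemigroup *-commutativeSemigroup
      using (interchange; x∙yz≈xz∙y)
    open import Relation.Binary.Reasoning.Setoid setoid

    sp≉0 : ∀ i → sp i ≉ 0#
    sp≉0 i = x*y≉0⇒x≉0 (λ sp²≈0 → p≉0 i (trans (sym (sp²≈p i)) sp²≈0))

    sq′≉0 : ∀ i → sq′ i ≉ 0#
    sq′≉0 i = x*y≉0⇒x≉0 (λ sq′²≈0 → q≉0 i (trans (sym (sq′²≈q i)) sq′²≈0))

    -- The factors 1# - z * w ^ⁿ k by which step k extends the Pochhammer symbols of Num (α) and of B₃, B₄, B₀ (β).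
    α₁ α₂ αₓ β₃ β₄ β₀ : ℕ → Carrier
    α₁ k = 1# - sq (a i1) / p i1 * p i1 ^ⁿ k
    α₂ k = 1# - sq (a i2) / p i2 * p i2 ^ⁿ k
    αₓ k = 1# - sq (x i1) * q i1 ^ⁿ k
    β₃ k = 1# - K * p i3 / (L * sq (a i3)) * (L / p i3) ^ⁿ k
    β₄ k = 1# - K * p i4 / (L * sq (a i4)) * (L / p i4) ^ⁿ k
    β₀ k = 1# - K₀ / sq (x i2) * (L₀ / q i2) ^ⁿ k

    L≉0 : L ≉ 0#
    L≉0 = x*y≉0 (x*y≉0 (x*y≉0 (sp≉0 i1) (sp≉0 i2)) (sp≉0 i3)) (sp≉0 i4)

    module E-Identity (k : ℕ) where
      m : ℤ
      m = + k ℤ.- + 1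

      t y : Fin 4 → Carrier
      t i = sp i ^ᶻ m
      y i = a i * t i

      t≉0 : ∀ i → t i ≉ 0#
      t≉0 i = ^ᶻ-≉0 m (sp≉0 i)

      y≉0 : ∀ i → y i ≉ 0#
      y≉0 i = x*y≉0 (a≉0 i) (t≉0 i)

      T : Carrier
      T = t i1 * t i2 * t i3 * t i4

      sp*sp^ᶻm : ∀ i j → (sp i * sp j) ^ᶻ m ≈ t i * t j
      sp*sp^ᶻm i j = ^ᶻ-distrib-* m (sp≉0 i) (sp≉0 j)

      spᵏ : ∀ i → sp i ^ⁿ k ≈ t i * sp i
      spᵏ i = ^ⁿ≈^ᶻ[n-1]*x k (sp≉0 i)

      pᵏ : ∀ i → p i ^ⁿ k ≈ sq (t i) * p i
      pᵏ i = begin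
        p i ^ⁿ k                    ≈⟨ ^ⁿ-cong k (sp²≈p i) ⟨
        (sp i * sp i) ^ⁿ k          ≈⟨ ^ⁿ-distrib-* (sp i) (sp i) k ⟩
        sp i ^ⁿ k * sp i ^ⁿ k       ≈⟨ *-cong (spᵏ i) (spᵏ i) ⟩
        t i * sp i * (t i * sp i)   ≈⟨ interchange _ _ _ _ ⟩
        sq (t i) * (sp i * sp i)    ≈⟨ *-congˡ (sp²≈p i) ⟩
        sq (t i) * p i              ∎

      Lᵏ : L ^ⁿ k ≈ T * L
      Lᵏ = begin
        L ^ⁿ k
          ≈⟨ ^ⁿ-distrib-*⁴ (sp i1) (sp i2) (sp i3) (sp i4) k ⟩
        sp i1 ^ⁿ k * sp i2 ^ⁿ k * sp i3 ^ⁿ k * sp i4 ^ⁿ k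
          ≈⟨ *-cong (*-cong (*-cong (spᵏ i1) (spᵏ i2)) (spᵏ i3)) (spᵏ i4) ⟩
        t i1 * sp i1 * (t i2 * sp i2) * (t i3 * sp i3) * (t i4 * sp i4)
          ≈⟨ solve 8 (λ t₁ s₁ t₂ s₂ t₃ s₃ t₄ s₄ →
                        t₁ :* s₁ :* (t₂ :* s₂) :* (t₃ :* s₃) :* (t₄ :* s₄) :=
                        t₁ :* t₂ :* t₃ :* t₄ :* (s₁ :* s₂ :* s₃ :* s₄))
               refl (t i1) (sp i1) (t i2) (sp i2) (t i3) (sp i3) (t i4) (sp i4) ⟩
        T * L ∎

      E-factor : ∀ j j′ → a i1 * (sp i1 * sp j) ^ᶻ m - a i2 * a j′ * (sp i2 * sp j′) ^ᶻ m / a j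
                            ≈ t j * (y i1 - y i2 * (y j′ / y j))
      E-factor j j′ = begin
        a i1 * (sp i1 * sp j) ^ᶻ m - a i2 * a j′ * (sp i2 * sp j′) ^ᶻ m / a j
          ≈⟨ +-cong (*-congˡ (sp*sp^ᶻm i1 j)) (-‿cong (*-congʳ (*-congˡ (sp*sp^ᶻm i2 j′)))) ⟩
        a i1 * (t i1 * t j) - a i2 * a j′ * (t i2 * t j′) / a j
          ≈⟨ +-congˡ (-‿cong (trans (*-congˡ (inverseʳ (t j) (t≉0 j))) (*-identityʳ _))) ⟨
        a i1 * (t i1 * t j) - a i2 * a j′ * (t i2 * t j′) / a j * (t j * t j ⁻¹)
          ≈⟨ solve 9 (λ a₁ t₁ a₂ t₂ a′ t′ tⱼ a⁻¹ t⁻¹ →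
                        a₁ :* (t₁ :* tⱼ) :- a₂ :* a′ :* (t₂ :* t′) :* a⁻¹ :* (tⱼ :* t⁻¹) :=
                        tⱼ :* (a₁ :* t₁ :- a₂ :* t₂ :* (a′ :* t′ :* (a⁻¹ :* t⁻¹))))
               refl (a i1) (t i1) (a i2) (t i2) (a j′) (t j′) (t j) (a j ⁻¹) (t j ⁻¹) ⟩
        t j * (y i1 - y i2 * (y j′ * (a j ⁻¹ * t j ⁻¹)))
          ≈⟨ *-congˡ (+-congˡ (-‿cong (*-congˡ (*-congˡ (⁻¹-distrib-* (a≉0 j) (t≉0 j)))))) ⟨
        t j * (y i1 - y i2 * (y j′ / y j)) ∎

      a-factor : ∀ i → sq (a i) / p i * p i ^ⁿ k ≈ y i * y i
      a-factor i = begin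
        sq (a i) / p i * p i ^ⁿ k              ≈⟨ *-congˡ (pᵏ i) ⟩
        sq (a i) / p i * (sq (t i) * p i)      ≈⟨ x/y*[z*y]≈x*z (p≉0 i) ⟩
        sq (a i) * sq (t i)                    ≈⟨ interchange _ _ _ _ ⟩
        y i * y i                              ∎

      z-factor : ∀ j j′ → K * T ≈ y j * (y i1 * y i2 * y j′) →
                 K * p j / (L * sq (a j)) * (L / p j) ^ⁿ k ≈ y i1 * y i2 * (y j′ / y j)
      z-factor j j′ KT≈ = begin
        K * p j / (L * sq (a j)) * (L / p j) ^ⁿ k
          ≈⟨ *-congˡ (/-^ⁿ k (p≉0 j)) ⟩
        K * p j / (L * sq (a j)) * (L ^ⁿ k / p j ^ⁿ k)
          ≈⟨ *-congˡ (/-cong (^ⁿ-≉0 k (p≉0 j)) Lᵏ (pᵏ j)) ⟩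
        K * p j / (L * sq (a j)) * (T * L / (sq (t j) * p j))
          ≈⟨ /-*-/ La²≉0 t²p≉0 ⟩
        K * p j * (T * L) / (L * sq (a j) * (sq (t j) * p j))
          ≈⟨ /-cong (x*y≉0 La²≉0 t²p≉0) numerator denominator ⟩
        L * p j * y j * (y i1 * y i2 * y j′) / (L * p j * y j * y j)
          ≈⟨ *-/-cancelˡ (x*y≉0 (x*y≉0 L≉0 (p≉0 j)) (y≉0 j)) (y≉0 j) ⟩
        y i1 * y i2 * y j′ / y j
          ≈⟨ *-assoc _ _ _ ⟩
        y i1 * y i2 * (y j′ / y j) ∎
        where
        La²≉0 : L * sq (a j) ≉ 0#
        La²≉0 = x*y≉0 L≉0 (x*y≉0 (a≉0 j) (a≉0 j))
        t²p≉0 : sq (t j) * p j ≉ 0#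
        t²p≉0 = x*y≉0 (x*y≉0 (t≉0 j) (t≉0 j)) (p≉0 j)
        numerator : K * p j * (T * L) ≈ L * p j * y j * (y i1 * y i2 * y j′)
        numerator = begin
          K * p j * (T * L)                      ≈⟨ solve 4 (λ K P T L → K :* P :* (T :* L) := L :* P :* (K :* T))
                                                      refl K (p j) T L ⟩
          L * p j * (K * T)                      ≈⟨ *-congˡ KT≈ ⟩
          L * p j * (y j * (y i1 * y i2 * y j′)) ≈⟨ *-assoc _ _ _ ⟨
          L * p j * y j * (y i1 * y i2 * y j′)   ∎
        denominator : L * sq (a j) * (sq (t j) * p j) ≈ L * p j * y j * y j
        denominator = solve 4 (λ L A T P → L :* (A :* A) :* (T :* T :* P) := L :* P :* (A :* T) :* (A :* T))
                        refl L (a j) (t j) (p j)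

      E-identity : E m / (sp i3 * sp i4) ^ᶻ m ≈ β₃ k * β₄ k - α₁ k * α₂ k
      E-identity = begin
        E m / (sp i3 * sp i4) ^ᶻ m
          ≈⟨ /-cong (^ᶻ-≉0 m (x*y≉0 (sp≉0 i3) (sp≉0 i4)))
                    (*-cong (E-factor i3 i4) (E-factor i4 i3)) (sp*sp^ᶻm i3 i4) ⟩
        t i3 * (u - v * ρ) * (t i4 * (u - v * σ)) / (t i3 * t i4)
          ≈⟨ *-congʳ (interchange _ _ _ _) ⟩
        t i3 * t i4 * ((u - v * ρ) * (u - v * σ)) / (t i3 * t i4)
          ≈⟨ x*y/x≈y (x*y≉0 (t≉0 i3) (t≉0 i4)) ⟩
        (u - v * ρ) * (u - v * σ)
          ≈⟨ reciprocal-product-identity u v ρ σ (x/y*[y/x]≈1 (y≉0 i4) (y≉0 i3)) ⟩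
        (1# - u * v * ρ) * (1# - u * v * σ) - (1# - u * u) * (1# - v * v)
          ≈⟨ +-cong (*-cong (1-‿cong (z-factor i3 i4 KT≈y₃[y₁y₂y₄]))
                            (1-‿cong (z-factor i4 i3 KT≈y₄[y₁y₂y₃])))
                    (-‿cong (*-cong (1-‿cong (a-factor i1)) (1-‿cong (a-factor i2)))) ⟨
        β₃ k * β₄ k - α₁ k * α₂ k ∎
        where
        u v ρ σ : Carrier
        u = y i1
        v = y i2
        ρ = y i4 / y i3
        σ = y i3 / y i4
        KT≈y₃[y₁y₂y₄] : K * T ≈ y i3 * (u * v * y i4)
        KT≈y₃[y₁y₂y₄] = solve 8 (λ a₁ a₂ a₃ a₄ t₁ t₂ t₃ t₄ →
                            a₁ :* a₂ :* a₃ :* a₄ :* (t₁ :* t₂ :* t₃ :* t₄) :=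
                            a₃ :* t₃ :* (a₁ :* t₁ :* (a₂ :* t₂) :* (a₄ :* t₄)))
                          refl (a i1) (a i2) (a i3) (a i4) (t i1) (t i2) (t i3) (t i4)
        KT≈y₄[y₁y₂y₃] : K * T ≈ y i4 * (u * v * y i3)
        KT≈y₄[y₁y₂y₃] = solve 8 (λ a₁ a₂ a₃ a₄ t₁ t₂ t₃ t₄ →
                            a₁ :* a₂ :* a₃ :* a₄ :* (t₁ :* t₂ :* t₃ :* t₄) :=
                            a₄ :* t₄ :* (a₁ :* t₁ :* (a₂ :* t₂) :* (a₃ :* t₃)))
                          refl (a i1) (a i2) (a i3) (a i4) (t i1) (t i2) (t i3) (t i4)

    module D-Identity (k : ℕ) where
      U ξ : Fin 4 → Carrier
      U i = sq′ i ^ⁿ k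
      ξ i = x i * U i

      U≉0 : ∀ i → U i ≉ 0#
      U≉0 i = ^ⁿ-≉0 k (sq′≉0 i)

      ξ≉0 : ∀ i → ξ i ≉ 0#
      ξ≉0 i = x*y≉0 (x≉0 i) (U≉0 i)

      qᵏ : ∀ i → q i ^ⁿ k ≈ sq (U i)
      qᵏ i = trans (^ⁿ-cong k (sym (sq′²≈q i))) (^ⁿ-distrib-* (sq′ i) (sq′ i) k)

      x*x*sq′*sq′ᵏ : ∀ i j → x i * x j * (sq′ i * sq′ j) ^ⁿ k ≈ ξ i * ξ j
      x*x*sq′*sq′ᵏ i j = trans (*-congˡ (^ⁿ-distrib-* (sq′ i) (sq′ j) k)) (interchange _ _ _ _)

      x-factor : sq (x i1) * q i1 ^ⁿ k ≈ ξ i1 * ξ i1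
      x-factor = trans (*-congˡ (qᵏ i1)) (interchange _ _ _ _)

      z₀-factor : K₀ / sq (x i2) * (L₀ / q i2) ^ⁿ k ≈ ξ i1 / ξ i2 * (ξ i3 * ξ i4)
      z₀-factor = begin
        K₀ / sq (x i2) * (L₀ / q i2) ^ⁿ k
          ≈⟨ *-congˡ (/-^ⁿ k (q≉0 i2)) ⟩
        K₀ / sq (x i2) * (L₀ ^ⁿ k / q i2 ^ⁿ k)
          ≈⟨ *-congˡ (/-cong (^ⁿ-≉0 k (q≉0 i2)) (^ⁿ-distrib-*⁴ (sq′ i1) (sq′ i2) (sq′ i3) (sq′ i4) k) (qᵏ i2)) ⟩
        K₀ / sq (x i2) * (U i1 * U i2 * U i3 * U i4 / sq (U i2))
          ≈⟨ /-*-/ x₂²≉0 U₂²≉0 ⟩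
        K₀ * (U i1 * U i2 * U i3 * U i4) / (sq (x i2) * sq (U i2))
          ≈⟨ /-cong (x*y≉0 x₂²≉0 U₂²≉0)
                    (solve 8 (λ x₁ x₂ x₃ x₄ U₁ U₂ U₃ U₄ →
                                x₁ :* x₂ :* x₃ :* x₄ :* (U₁ :* U₂ :* U₃ :* U₄) :=
                                x₂ :* U₂ :* (x₁ :* U₁ :* (x₃ :* U₃ :* (x₄ :* U₄))))
                       refl (x i1) (x i2) (x i3) (x i4) (U i1) (U i2) (U i3) (U i4))
                    (interchange _ _ _ _) ⟩
        ξ i2 * (ξ i1 * (ξ i3 * ξ i4)) / (ξ i2 * ξ i2)
          ≈⟨ *-/-cancelˡ (ξ≉0 i2) (ξ≉0 i2) ⟩
        ξ i1 * (ξ i3 * ξ i4) / ξ i2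
          ≈⟨ trans (*-assoc _ _ _) (x∙yz≈xz∙y _ _ _) ⟩
        ξ i1 / ξ i2 * (ξ i3 * ξ i4) ∎
        where
        x₂²≉0 : sq (x i2) ≉ 0#
        x₂²≉0 = x*y≉0 (x≉0 i2) (x≉0 i2)
        U₂²≉0 : sq (U i2) ≉ 0#
        U₂²≉0 = x*y≉0 (U≉0 i2) (U≉0 i2)

      D-identity : x i1 / x i2 * (D k * (sq′ i1 / sq′ i2) ^ⁿ k) ≈ β₀ k - αₓ k
      D-identity = begin
        x i1 / x i2 * (D k * (sq′ i1 / sq′ i2) ^ⁿ k)
          ≈⟨ *-congˡ (*-cong (+-cong (x*x*sq′*sq′ᵏ i1 i2) (-‿cong (x*x*sq′*sq′ᵏ i3 i4)))
                              (/-^ⁿ k (sq′≉0 i2))) ⟩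
        x i1 / x i2 * ((ξ i1 * ξ i2 - ξ i3 * ξ i4) * (U i1 / U i2))
          ≈⟨ x∙yz≈xz∙y _ _ _ ⟩
        x i1 / x i2 * (U i1 / U i2) * (ξ i1 * ξ i2 - ξ i3 * ξ i4)
          ≈⟨ *-congʳ (/-*-/ (x≉0 i2) (U≉0 i2)) ⟩
        ξ i1 / ξ i2 * (ξ i1 * ξ i2 - ξ i3 * ξ i4)
          ≈⟨ quotient-product-identity _ _ _ _ (x/y*y≈x (ξ≉0 i2)) ⟩
        (1# - ξ i1 / ξ i2 * (ξ i3 * ξ i4)) - (1# - ξ i1 * ξ i1)
          ≈⟨ +-cong (1-‿cong z₀-factor) (-‿cong (1-‿cong x-factor)) ⟨
        β₀ k - αₓ k ∎

    open E-Identity using (E-identity)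
    open D-Identity using (D-identity)

    R : ℕ → Carrier
    R n = Num n / (B₃ n * B₄ n * B₀ n)

    R₀≈1 : R 0 ≈ 1#
    R₀≈1 = inverseʳ _ (x*y≉0 (x*y≉0 1≉0 1≉0) 1≉0)

    summand-telescopes : ∀ k → B₃ (suc k) * B₄ (suc k) * B₀ (suc k) ≉ 0# →
      T₁ k + x i1 / x i2 * T₂ k ≈ R k - R (suc k)
    summand-telescopes k Bₖ₊₁≉0 = begin
      T₁ k + x i1 / x i2 * T₂ k
        ≈⟨ +-cong (*-congʳ (E-identity k)) (trans (sym (*-assoc _ _ _)) (*-congʳ (D-identity k))) ⟩
      (β₃ k * β₄ k - α₁ k * α₂ k) * (Num k / (B₃ (suc k) * B₄ (suc k) * B₀ k))
        + (β₀ k - αₓ k) * (Num' k / (B₃ (suc k) * B₄ (suc k) * B₀ (suc k)))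
        ≈⟨ ratio-difference Bₖ₊₁≉0 (rearrange (poch (sq (a i1) / p i1) (p i1) k) (α₁ k)
                                               (poch (sq (a i2) / p i2) (p i2) k) (α₂ k)
                                               (poch (sq (x i1)) (q i1) k))
                                    (sym (*-assoc _ _ _))
                                    (rearrange (B₃ k) (β₃ k) (B₄ k) (β₄ k) (B₀ k))
                                    (sym (*-assoc _ _ _)) ⟨
      R k - R (suc k) ∎
      where
      rearrange : ∀ x₁ y₁ x₂ y₂ x₃ → x₁ * y₁ * (x₂ * y₂) * x₃ ≈ x₁ * x₂ * x₃ * (y₁ * y₂)
      rearrange = solve 5 (λ x₁ y₁ x₂ y₂ x₃ → x₁ :* y₁ :* (x₂ :* y₂) :* x₃ := x₁ :* x₂ :* x₃ :* (y₁ :* y₂)) refl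

    summands-telescope-below : ∀ n → B₃ n ≉ 0# → B₄ n ≉ 0# → B₀ n ≉ 0# →
      ∀ k → k < n → T₁ k + x i1 / x i2 * T₂ k ≈ R k - R (suc k)
    summands-telescope-below n B₃≉0 B₄≉0 B₀≉0 k k<n = summand-telescopes k
      (x*y≉0 (x*y≉0 (poch-≉0-≤ k<n B₃≉0) (poch-≉0-≤ k<n B₄≉0)) (poch-≉0-≤ k<n B₀≉0))

theorem2p2 : ∀ {c ℓ} (F : Field c ℓ) → let open Field F in let open WithField F in
    (a p sp x q sq' : Fin 4 → Carrier) →
    (∀ i → ¬ (a i ≈ 0#)) → (∀ i → ¬ (p i ≈ 0#)) →
    (∀ i → ¬ (x i ≈ 0#)) → (∀ i → ¬ (q i ≈ 0#)) →
    (∀ i → (sp i * sp i) ≈ p i) → (∀ i → (sq' i * sq' i) ≈ q i) →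
    (n : ℕ) →
    let open Quantities a p sp x q sq' in
    ¬ (B₃ n ≈ 0#) → ¬ (B₄ n ≈ 0#) → ¬ (B₀ n ≈ 0#) →
    LHS n ≈ RHS n
theorem2p2 F a p sp x q sq′ a≉0 p≉0 x≉0 q≉0 sp²≈p sq′²≈q n B₃≉0 B₄≉0 B₀≉0 = begin
  sumTo n T₁
    ≈⟨ sumTo-telescoping n T₁ (λ k → x i1 / x i2 * T₂ k) R
         (summands-telescope-below n B₃≉0 B₄≉0 B₀≉0) ⟩
  R 0 - R n - sumTo n (λ k → x i1 / x i2 * T₂ k)
    ≈⟨ +-cong (+-congʳ R₀≈1) (-‿cong (sumTo-*ˡ n (x i1 / x i2) T₂)) ⟩
  1# - R n - x i1 / x i2 * sumTo n T₂ ∎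
  where
  open Field F
  open WithField F
  open Quantities a p sp x q sq′
  open FieldProperties F using (sumTo-telescoping; sumTo-*ˡ)
  open Telescoping.Summands F a p sp x q sq′ a≉0 p≉0 x≉0 q≉0 sp²≈p sq′²≈q
  open import Relation.Binary.Reasoning.Setoid setoid
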